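{- Let $t$ be an LSC term and let $C, D$ be (general) contexts with $C\prec_p t$ and $D\prec_p t$. Then either $C\prec_{LO} D$, or $D\prec_{LO}C$, or $C=D$.
   Context: LSC terms: $t::= x\mid \lambda x.t\mid tu\mid t[x\leftarrow u]$ (explicit substitution binding $x$). General contexts $C::=\langle\cdot\rangle\mid \lambda x.C\mid Ct\mid tC\mid C[x\leftarrow t]\mid t[x\leftarrow C]$; plugging $C\langle u\rangle$ may capture variables. $C\prec_p t$ means $t=C\langle u\rangle$ for some $u$. Outside-in order: $\langle\cdot\rangle\prec_O C$ for every $C\neq\langle\cdot\rangle$, and $C\prec_O D$ implies $E\langle C\rangle\prec_O E\langle D\rangle$ for every context $E$. Left-to-right order: if $C\prec_p t$ and $D\prec_p u$ then $Cu\prec_L tD$ and $C[x\leftarrow u]\prec_L t[x\leftarrow D]$; and $C\prec_L D$ implies $E\langle C\rangle\prec_L E\langle D\rangle$. $C\prec_{LO}D$ iff $C\prec_O D$ or $C\prec_L D$. -}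

module Defs where

open import Data.Nat using (ℕ)
open import Data.Product using (∃)
open import Relation.Binary.PropositionalEquality using (_≡_; _≢_)

-- Variables are represented by natural numbers (names); terms are
-- first-order syntax with named binders (no quotienting by α).
Var : Set
Var = ℕ

data Term : Set where
  var  : Var → Term
  lam  : Var → Term → Term
  app  : Term → Term → Term
  esub : Term → Var → Term → Term   -- esub t x u  is  t[x←u]

data Ctx : Set where
  hole  : Ctx
  lamC  : Var → Ctx → Ctx
  appL  : Ctx → Term → Ctx
  appR  : Term → Ctx → Ctx
  esubL : Ctx → Var → Term → Ctx
  esubR : Term → Var → Ctx → Ctx

-- Plugging C⟨u⟩ (purely syntactic, so it may capture variables).
plug : Ctx → Term → Term
plug hole          u = u
plug (lamC x C)    u = lam x (plug C u)
plug (appL C t)    u = app (plug C u) t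
plug (appR t C)    u = app t (plug C u)
plug (esubL C x t) u = esub (plug C u) x t
plug (esubR t x C) u = esub t x (plug C u)

plugC : Ctx → Ctx → Ctx
plugC hole          C = C
plugC (lamC x E)    C = lamC x (plugC E C)
plugC (appL E t)    C = appL (plugC E C) t
plugC (appR t E)    C = appR t (plugC E C)
plugC (esubL E x t) C = esubL (plugC E C) x t
plugC (esubR t x E) C = esubR t x (plugC E C)

_≺p_ : Ctx → Term → Set
C ≺p t = ∃ λ u → plug C u ≡ t

data _≺O_ : Ctx → Ctx → Set where
  O-hole : ∀ {C} → C ≢ hole → hole ≺O C
  O-ctx  : ∀ {C D} (E : Ctx) → C ≺O D → plugC E C ≺O plugC E D

data _≺L_ : Ctx → Ctx → Set where
  L-app  : ∀ {C D t u} → C ≺p t → D ≺p u → appL C u ≺L appR t D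
  L-esub : ∀ {C D t u x} → C ≺p t → D ≺p u → esubL C x u ≺L esubR t x D
  L-ctx  : ∀ {C D} (E : Ctx) → C ≺L D → plugC E C ≺L plugC E D

data _≺LO_ (C D : Ctx) : Set where
  viaO : C ≺O D → C ≺LO D
  viaL : C ≺L D → C ≺LO D

module Submission where

open import Defs
open import Data.Product using (_×_; _,_)
open import Data.Sum using (_⊎_; inj₁; inj₂)
open import Relation.Binary.PropositionalEquality using (_≡_; refl; sym; trans)

-- Two decompositions C⟨u⟩ = D⟨v⟩ of the same term agree on a common prefix E.
-- Where they first differ, either one of them is the hole (an outside-in
-- step) or they enter opposite sides of an application or explicit
-- substitution (a left-to-right step); a common prefix lifts the comparison
-- by the context closure of both orders.

Comparable : Ctx → Ctx → Set
Comparable C D = (C ≺LO D) ⊎ ((D ≺LO C) ⊎ (C ≡ D))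

comparable-sym : ∀ {C D} → Comparable C D → Comparable D C
comparable-sym (inj₁ C≺D)        = inj₂ (inj₁ C≺D)
comparable-sym (inj₂ (inj₁ D≺C)) = inj₁ D≺C
comparable-sym (inj₂ (inj₂ C≡D)) = inj₂ (inj₂ (sym C≡D))

comparable-plugC : (E : Ctx) {C D : Ctx} →
  Comparable C D → Comparable (plugC E C) (plugC E D)
comparable-plugC E (inj₁ (viaO C≺D))        = inj₁ (viaO (O-ctx E C≺D))
comparable-plugC E (inj₁ (viaL C≺D))        = inj₁ (viaL (L-ctx E C≺D))
comparable-plugC E (inj₂ (inj₁ (viaO D≺C))) = inj₂ (inj₁ (viaO (O-ctx E D≺C)))
comparable-plugC E (inj₂ (inj₁ (viaL D≺C))) = inj₂ (inj₁ (viaL (L-ctx E D≺C)))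
comparable-plugC E (inj₂ (inj₂ refl))       = inj₂ (inj₂ refl)

hole-comparable : (D : Ctx) → Comparable hole D
hole-comparable hole            = inj₂ (inj₂ refl)
hole-comparable (lamC _ _)      = inj₁ (viaO (O-hole λ ()))
hole-comparable (appL _ _)      = inj₁ (viaO (O-hole λ ()))
hole-comparable (appR _ _)      = inj₁ (viaO (O-hole λ ()))
hole-comparable (esubL _ _ _)   = inj₁ (viaO (O-hole λ ()))
hole-comparable (esubR _ _ _)   = inj₁ (viaO (O-hole λ ()))

lam-injective : ∀ {x y a b} → lam x a ≡ lam y b → x ≡ y × a ≡ b
lam-injective refl = refl , refl

app-injective : ∀ {a b c d} → app a b ≡ app c d → a ≡ c × b ≡ d
app-injective refl = refl , refl

esub-injective : ∀ {a x b c y d} →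
  esub a x b ≡ esub c y d → a ≡ c × x ≡ y × b ≡ d
esub-injective refl = refl , refl , refl

comparable-of-plug≡ : (C D : Ctx) (u v : Term) → plug C u ≡ plug D v →
  Comparable C D
comparable-of-plug≡ hole D _ _ _ = hole-comparable D
comparable-of-plug≡ C hole _ _ _ = comparable-sym (hole-comparable C)
comparable-of-plug≡ (lamC x C) (lamC _ D) u v e with lam-injective e
... | refl , e′ = comparable-plugC (lamC x hole) (comparable-of-plug≡ C D u v e′)
comparable-of-plug≡ (appL C s) (appL D _) u v e with app-injective e
... | e′ , refl = comparable-plugC (appL hole s) (comparable-of-plug≡ C D u v e′)
comparable-of-plug≡ (appR s C) (appR _ D) u v e with app-injective e
... | refl , e′ = comparable-plugC (appR s hole) (comparable-of-plug≡ C D u v e′)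
comparable-of-plug≡ (esubL C x s) (esubL D _ _) u v e with esub-injective e
... | e′ , refl , refl =
  comparable-plugC (esubL hole x s) (comparable-of-plug≡ C D u v e′)
comparable-of-plug≡ (esubR s x C) (esubR _ _ D) u v e with esub-injective e
... | refl , refl , e′ =
  comparable-plugC (esubR s x hole) (comparable-of-plug≡ C D u v e′)
comparable-of-plug≡ (appL C _) (appR _ D) u v e with app-injective e
... | e₁ , e₂ = inj₁ (viaL (L-app (u , e₁) (v , sym e₂)))
comparable-of-plug≡ (appR _ C) (appL D _) u v e with app-injective e
... | e₁ , e₂ = inj₂ (inj₁ (viaL (L-app (v , sym e₁) (u , e₂))))
comparable-of-plug≡ (esubL C _ _) (esubR _ _ D) u v e with esub-injective e
... | e₁ , refl , e₂ = inj₁ (viaL (L-esub (u , e₁) (v , sym e₂)))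
comparable-of-plug≡ (esubR _ _ C) (esubL D _ _) u v e with esub-injective e
... | e₁ , refl , e₂ = inj₂ (inj₁ (viaL (L-esub (v , sym e₁) (u , e₂))))
comparable-of-plug≡ (lamC _ _)    (appL _ _)    _ _ ()
comparable-of-plug≡ (lamC _ _)    (appR _ _)    _ _ ()
comparable-of-plug≡ (lamC _ _)    (esubL _ _ _) _ _ ()
comparable-of-plug≡ (lamC _ _)    (esubR _ _ _) _ _ ()
comparable-of-plug≡ (appL _ _)    (lamC _ _)    _ _ ()
comparable-of-plug≡ (appL _ _)    (esubL _ _ _) _ _ ()
comparable-of-plug≡ (appL _ _)    (esubR _ _ _) _ _ ()
comparable-of-plug≡ (appR _ _)    (lamC _ _)    _ _ ()
comparable-of-plug≡ (appR _ _)    (esubL _ _ _) _ _ ()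
comparable-of-plug≡ (appR _ _)    (esubR _ _ _) _ _ ()
comparable-of-plug≡ (esubL _ _ _) (lamC _ _)    _ _ ()
comparable-of-plug≡ (esubL _ _ _) (appL _ _)    _ _ ()
comparable-of-plug≡ (esubL _ _ _) (appR _ _)    _ _ ()
comparable-of-plug≡ (esubR _ _ _) (lamC _ _)    _ _ ()
comparable-of-plug≡ (esubR _ _ _) (appL _ _)    _ _ ()
comparable-of-plug≡ (esubR _ _ _) (appR _ _)    _ _ ()

mainTheorem16 : (t : Term) (C D : Ctx) → C ≺p t → D ≺p t →
    (C ≺LO D) ⊎ ((D ≺LO C) ⊎ (C ≡ D))
mainTheorem16 t C D (u , C⟨u⟩≡t) (v , D⟨v⟩≡t) =
  comparable-of-plug≡ C D u v (trans C⟨u⟩≡t (sym D⟨v⟩≡t))
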